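{- Let $n,t \in \mathbb{N}$, let $\mathcal{H}$ be an $n$-vertex hypergraph with more than $tn$ edges, and let $r := e(\mathcal{H}) - tn$. If there exist distinct pairwise intersecting edges $e_1 , \dots , e_{2r+2} \in \mathcal{H}$ such that $\{e_{2i-1} , e_{2i}\}$ is $t$-useful for every $i \in [r+1]$, then $\chi_\ell'(\mathcal{H}) < tn$.
   Context: A hypergraph $\mathcal H$ consists of a finite vertex set $V(\mathcal H)$ and a finite set of edges, each edge $e$ equipped with a non-empty set $V(e)\subseteq V(\mathcal H)$ (multiple edges allowed); $n$-vertex means $|V(\mathcal H)|=n$; $e(\mathcal H)$ is the number of edges. Edges are pairwise intersecting if their vertex sets pairwise intersect. $N(e)$ is the set of edges $f\ne e$ with $V(e)\cap V(f)\neq\varnothing$. A pair $\{e,f\}$ of distinct edges of an $n$-vertex hypergraph is $t$-useful if $V(e)\cap V(f)\neq\varnothing$ and $|N(e)\cap N(f)|\le tn-3$. A proper edge-colouring gives distinct colours to distinct edges with intersecting vertex sets; $\chi'_\ell(\mathcal H)$ (list chromatic index) is the least $m$ such that for every assignment of lists $C(e)$ with $|C(e)|\ge m$ there is a proper edge-colouring $\phi$ with $\phi(e)\in C(e)$ for all $e$. -}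

module Defs where

open import Data.Nat using (ℕ; _+_; _*_; _≤_; _<_; _∸_)
open import Data.Fin using (Fin; _≟_)
open import Data.Bool using (Bool; true; false; _∧_; not)
open import Data.List using (List; length; filter)
open import Data.Bool.ListAction using (any)
open import Data.List.Membership.Propositional using (_∈_)
open import Data.List.Relation.Unary.Unique.Propositional using (Unique)
open import Data.Vec.Functional using (Vector)
open import Data.Fin.Base using () 
open import Data.List.Base using () renaming (map to lmap)
open import Data.Product using (Σ; _×_; ∃)
open import Relation.Binary.PropositionalEquality using (_≡_; _≢_)
open import Relation.Nullary using (¬_; does)
open import Data.Bool using (T)

allFin : (k : ℕ) → List (Fin k)
allFin k = Data.List.Base.allFin k

-- A hypergraph on vertex set Fin n with m edges (indexed by Fin m; multiple
-- edges allowed). V e v = true  iff  vertex v belongs to the vertex set of edge e.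
record Hypergraph (n : ℕ) : Set where
  field
    m        : ℕ
    V        : Fin m → Fin n → Bool
    nonempty : (e : Fin m) → Σ (Fin n) (λ v → T (V e v))

module _ {n : ℕ} (H : Hypergraph n) where
  open Hypergraph H

  numEdges : ℕ
  numEdges = m

  meets : Fin m → Fin m → Bool
  meets e f = any (λ v → V e v ∧ V f v) (allFin n)

  inN : Fin m → Fin m → Bool
  inN e g = not (does (g ≟ e)) ∧ meets e g

  commonNbrs : Fin m → Fin m → ℕ
  commonNbrs e f = length (filter (λ g → T? (inN e g ∧ inN f g)) (allFin m))
    where
      open import Relation.Nullary.Decidable using (Dec)
      open import Data.Bool.Properties using () renaming (T? to T?)

  -- {e,f} is t-useful: e ≠ f, V(e) ∩ V(f) ≠ ∅, |N(e) ∩ N(f)| ≤ t n - 3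
  -- (the inequality is stated over the integers as |N(e)∩N(f)| + 3 ≤ t n,
  --  avoiding truncated subtraction).
  Useful : ℕ → Fin m → Fin m → Set
  Useful t e f = (e ≢ f) × T (meets e f) × (commonNbrs e f + 3 ≤ t * n)

  PairwiseIntersecting : {k : ℕ} → (Fin k → Fin m) → Set
  PairwiseIntersecting es = ∀ i j → T (meets (es i) (es j))

  Proper : (Fin m → ℕ) → Set
  Proper φ = ∀ e f → e ≢ f → T (meets e f) → φ e ≢ φ f

  EdgeChoosable : ℕ → Set
  EdgeChoosable k = (C : Fin m → List ℕ) →
    (∀ e → Unique (C e)) → (∀ e → k ≤ length (C e)) →
    Σ (Fin m → ℕ) (λ φ → Proper φ × (∀ e → φ e ∈ C e))

  -- χ'_ℓ(H) < b  (χ'_ℓ is the least k with EdgeChoosable k)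
  ListChromaticIndexLessThan : ℕ → Set
  ListChromaticIndexLessThan b = Σ ℕ (λ k → k < b × EdgeChoosable k)

{-# OPTIONS --safe #-}
-- Work in the line graph, with lists of size k = tn - 1 on all m = k + (r + 1) edges, and keep the
-- r + 1 useful pairs in a list P.  While some edge x of a pair in P has a non-neighbour y that shares
-- a colour a with it, colour x and y with a, delete a from every other list and drop the pair of x:
-- k, |P| and the number of uncoloured edges S drop by 1, 1 and 2, so |S| ≤ k + |P| persists, and
-- every remaining pair, being adjacent to x, loses the common neighbour x.  Once no such x, y exist,
-- Hall's condition holds on S: a set Y with |Y| > k either contains such a non-adjacent x, y, whose
-- disjoint lists already give 2k ≥ |S| colours; or contains a whole pair and so lies in its common
-- neighbourhood plus the pair, |Y| ≤ k; or meets each pair at most once, |Y| ≤ |S| - |P| ≤ k.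
-- A system of distinct representatives then colours S.
module Submission where

open import Defs
open import Data.Bool.Base using (Bool; true; false; T; _∧_; not)
open import Data.Bool.ListAction using (or)
open import Data.Bool.Properties using (T?; T-≡; ∧-comm)
open import Data.Fin.Base using (Fin; zero; suc; toℕ; fromℕ<; combine)
open import Data.Fin.Properties using (_≟_; any?; toℕ-fromℕ<; toℕ-injective; combine-injective; injective⇒≤)
open import Data.Fin.Subset
open import Data.Fin.Subset.Properties
open import Data.List.Base using (List; []; _∷_; length; filter; concat; map)
import Data.List.Base as List using (allFin; tabulate)
open import Data.List.Extrema.Nat using (max; xs≤max)
import Data.List.Membership.Propositional as List
open import Data.List.Membership.Propositional using (find; lose)
open import Data.List.Membership.Propositional.Properties using (∈-allFin; ∈-map⁺; ∈-map⁻; ∈-concat⁺′)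
open import Data.List.Properties using (map-cong; length-map; length-tabulate)
open import Data.List.Relation.Unary.All as All using (All; []; _∷_)
open import Data.List.Relation.Unary.All.Properties using (All¬⇒¬Any)
open import Data.List.Relation.Unary.AllPairs using ([]; _∷_)
open import Data.List.Relation.Unary.Any using (here; there)
import Data.List.Relation.Unary.Any as Any
open import Data.List.Relation.Unary.Unique.Propositional using (Unique)
open import Data.List.Relation.Unary.Unique.Propositional.Properties using (allFin⁺)
open import Data.Nat.Base using (ℕ; zero; suc; pred; _+_; _*_; _∸_; _≤_; _<_; s≤s; z≤n; >-nonZero)
open import Data.Nat.Properties hiding (_≟_)
open import Data.Nat.Properties using () renaming (_≟_ to _≟ℕ_)
open import Data.List.Membership.DecPropositional _≟ℕ_ using () renaming (_∈?_ to _∈ℕ?_)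
open import Data.Product using (∃-syntax; _×_; _,_; proj₁; proj₂)
open import Data.Sum using (_⊎_; inj₁; inj₂; [_,_]′)
open import Data.Unit using (tt) renaming (⊤ to Unit)
open import Data.Vec.Base using (tabulate; []; _∷_; here; there)
open import Data.Vec.Properties using (lookup∘tabulate; lookup⇒[]=; []=⇒lookup)
open import Function.Base using (_∘_)
open import Function.Bundles using (Equivalence)
open import Function.Definitions using (Injective)
open import Relation.Binary.PropositionalEquality
open import Relation.Nullary using (¬_; yes; no; ¬?; Dec; does)
open import Relation.Nullary.Decidable using (_×-dec_; isYes; toWitness; fromWitness; map′)
open import Relation.Nullary.Negation using (contradiction)
open import Relation.Unary using (Decidable)

private variable
  n m c : ℕ
  x v w : Fin n
  p q X Y Z S : Subset n
  L L′ : Fin m → Subset c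
  P : List (Fin m × Fin m)

∣p∪q∣+∣p∩q∣≡∣p∣+∣q∣ : ∀ (p q : Subset n) → ∣ p ∪ q ∣ + ∣ p ∩ q ∣ ≡ ∣ p ∣ + ∣ q ∣
∣p∪q∣+∣p∩q∣≡∣p∣+∣q∣ []          []          = refl
∣p∪q∣+∣p∩q∣≡∣p∣+∣q∣ (true  ∷ p) (true  ∷ q) =
  cong suc (trans (+-suc _ _) (trans (cong suc (∣p∪q∣+∣p∩q∣≡∣p∣+∣q∣ p q)) (sym (+-suc _ _))))
∣p∪q∣+∣p∩q∣≡∣p∣+∣q∣ (true  ∷ p) (false ∷ q) = cong suc (∣p∪q∣+∣p∩q∣≡∣p∣+∣q∣ p q)
∣p∪q∣+∣p∩q∣≡∣p∣+∣q∣ (false ∷ p) (true  ∷ q) =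
  trans (cong suc (∣p∪q∣+∣p∩q∣≡∣p∣+∣q∣ p q)) (sym (+-suc _ _))
∣p∪q∣+∣p∩q∣≡∣p∣+∣q∣ (false ∷ p) (false ∷ q) = ∣p∪q∣+∣p∩q∣≡∣p∣+∣q∣ p q

∣p∪q∣≤∣p∣+∣q∣ : ∀ (p q : Subset n) → ∣ p ∪ q ∣ ≤ ∣ p ∣ + ∣ q ∣
∣p∪q∣≤∣p∣+∣q∣ p q = m+n≤o⇒m≤o _ (≤-reflexive (∣p∪q∣+∣p∩q∣≡∣p∣+∣q∣ p q))

Empty[p∩q]⇒∣p∪q∣≡∣p∣+∣q∣ : ∀ (p q : Subset n) → Empty (p ∩ q) → ∣ p ∪ q ∣ ≡ ∣ p ∣ + ∣ q ∣
Empty[p∩q]⇒∣p∪q∣≡∣p∣+∣q∣ {n} p q p∩q-empty = begin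
  ∣ p ∪ q ∣              ≡⟨ +-identityʳ _ ⟨
  ∣ p ∪ q ∣ + 0          ≡⟨ cong (∣ p ∪ q ∣ +_) (∣⊥∣≡0 n) ⟨
  ∣ p ∪ q ∣ + ∣ ⊥ {n} ∣  ≡⟨ cong (λ r → ∣ p ∪ q ∣ + ∣ r ∣) (Empty-unique p∩q-empty) ⟨
  ∣ p ∪ q ∣ + ∣ p ∩ q ∣  ≡⟨ ∣p∪q∣+∣p∩q∣≡∣p∣+∣q∣ p q ⟩
  ∣ p ∣ + ∣ q ∣          ∎
  where open ≡-Reasoning

∣p∣≡∣p∩q∣+∣p─q∣ : ∀ (p q : Subset n) → ∣ p ∣ ≡ ∣ p ∩ q ∣ + ∣ p ─ q ∣
∣p∣≡∣p∩q∣+∣p─q∣ []          []          = refl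
∣p∣≡∣p∩q∣+∣p─q∣ (true  ∷ p) (true  ∷ q) = cong suc (∣p∣≡∣p∩q∣+∣p─q∣ p q)
∣p∣≡∣p∩q∣+∣p─q∣ (true  ∷ p) (false ∷ q) = trans (cong suc (∣p∣≡∣p∩q∣+∣p─q∣ p q)) (sym (+-suc _ _))
∣p∣≡∣p∩q∣+∣p─q∣ (false ∷ p) (true  ∷ q) = ∣p∣≡∣p∩q∣+∣p─q∣ p q
∣p∣≡∣p∩q∣+∣p─q∣ (false ∷ p) (false ∷ q) = ∣p∣≡∣p∩q∣+∣p─q∣ p q

x∈p⇒0<∣p∣ : x ∈ p → 0 < ∣ p ∣
x∈p⇒0<∣p∣ {x = x} x∈p = subst (_≤ _) (∣⁅x⁆∣≡1 x) (p⊆q⇒∣p∣≤∣q∣ ⁅x⁆⊆p)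
  where
  ⁅x⁆⊆p : ⁅ x ⁆ ⊆ _
  ⁅x⁆⊆p y∈⁅x⁆ = subst (_∈ _) (sym (x∈⁅y⁆⇒x≡y x y∈⁅x⁆)) x∈p

0<∣p∣⇒Nonempty : 0 < ∣ p ∣ → Nonempty p
0<∣p∣⇒Nonempty {p = true  ∷ p} _ = zero , here
0<∣p∣⇒Nonempty {p = false ∷ p} 0<∣p∣ with (x , x∈p) ← 0<∣p∣⇒Nonempty {p = p} 0<∣p∣ = suc x , there x∈p

∣p∣≤1+∣p-x∣ : ∀ (p : Subset n) x → ∣ p ∣ ≤ suc ∣ p - x ∣
∣p∣≤1+∣p-x∣ p x = begin
  ∣ p ∣                       ≡⟨ ∣p∣≡∣p∩q∣+∣p─q∣ p ⁅ x ⁆ ⟩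
  ∣ p ∩ ⁅ x ⁆ ∣ + ∣ p - x ∣   ≤⟨ +-monoˡ-≤ _ (≤-trans (∣p∩q∣≤∣q∣ p ⁅ x ⁆) (≤-reflexive (∣⁅x⁆∣≡1 x))) ⟩
  suc ∣ p - x ∣               ∎
  where open ≤-Reasoning

x∈p─q⇒x∉q : ∀ (p q : Subset n) → x ∈ p ─ q → x ∉ q
x∈p─q⇒x∉q (true  ∷ p) (false ∷ q) here        ()
x∈p─q⇒x∉q (_     ∷ p) (_     ∷ q) (there x∈) (there x∈q) = x∈p─q⇒x∉q p q x∈ x∈q

x∈p-y⇒x≢y : ∀ (p : Subset n) {y} → x ∈ p - y → x ≢ y
x∈p-y⇒x≢y p {y} x∈ = x∉⁅y⁆⇒x≢y (x∈p─q⇒x∉q p ⁅ y ⁆ x∈)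

∈tabulate⁺ : ∀ {f : Fin n → Bool} → T (f x) → x ∈ tabulate f
∈tabulate⁺ {x = x} {f = f} fx =
  lookup⇒[]= x (tabulate f) (trans (lookup∘tabulate f x) (Equivalence.to T-≡ fx))

∈tabulate⁻ : ∀ {f : Fin n → Bool} → x ∈ tabulate f → T (f x)
∈tabulate⁻ {x = x} {f = f} x∈ =
  Equivalence.from T-≡ (trans (sym (lookup∘tabulate f x)) ([]=⇒lookup x∈))

tabulate∩tabulate : ∀ (p q : Fin n → Bool) → tabulate p ∩ tabulate q ≡ tabulate (λ i → p i ∧ q i)
tabulate∩tabulate {zero}  p q = refl
tabulate∩tabulate {suc n} p q = cong (p zero ∧ q zero ∷_) (tabulate∩tabulate (p ∘ suc) (q ∘ suc))

∣tabulate∣≡length-filter : ∀ {A : Set} (p : A → Bool) (f : Fin n → A) →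
                           ∣ tabulate (p ∘ f) ∣ ≡ length (filter (T? ∘ p) (List.tabulate f))
∣tabulate∣≡length-filter {zero}  p f = refl
∣tabulate∣≡length-filter {suc n} p f with p (f zero)
... | true  = cong suc (∣tabulate∣≡length-filter p (f ∘ suc))
... | false = ∣tabulate∣≡length-filter p (f ∘ suc)

image : (Fin m → Subset c) → Subset m → Subset c
image L []          = ⊥
image L (true  ∷ Y) = L zero ∪ image (L ∘ suc) Y
image L (false ∷ Y) = image (L ∘ suc) Y

∈image⁺ : ∀ {L : Fin m → Subset c} {Y a} → v ∈ Y → a ∈ L v → a ∈ image L Y
∈image⁺ {L = L} {Y = true  ∷ Y} here       a∈Lv = x∈p∪q⁺ (inj₁ a∈Lv)
∈image⁺ {L = L} {Y = true  ∷ Y} (there v∈Y) a∈Lv = x∈p∪q⁺ (inj₂ (∈image⁺ {L = L ∘ suc} v∈Y a∈Lv))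
∈image⁺ {L = L} {Y = false ∷ Y} (there v∈Y) a∈Lv = ∈image⁺ {L = L ∘ suc} v∈Y a∈Lv

∈image⁻ : ∀ (L : Fin m → Subset c) Y {a} → a ∈ image L Y → ∃[ v ] v ∈ Y × a ∈ L v
∈image⁻ L []          a∈ = contradiction a∈ ∉⊥
∈image⁻ L (true ∷ Y) a∈ with x∈p∪q⁻ (L zero) (image (L ∘ suc) Y) a∈
... | inj₁ a∈L0 = zero , here , a∈L0
... | inj₂ a∈   with v , v∈Y , a∈Lv ← ∈image⁻ (L ∘ suc) Y a∈ = suc v , there v∈Y , a∈Lv
∈image⁻ L (false ∷ Y) a∈ with v , v∈Y , a∈Lv ← ∈image⁻ (L ∘ suc) Y a∈ = suc v , there v∈Y , a∈Lv

-- A colour is only demanded for members of X: with no colours at all (c = 0) the empty set must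
-- still be colourable.
record Colouring (Adj : Fin m → Fin m → Set) (L : Fin m → Subset c) (X : Subset m) : Set where
  field
    colour  : v ∈ X → Fin c
    colour∈ : (v∈X : v ∈ X) → colour v∈X ∈ L v
    proper  : (v∈X : v ∈ X) (w∈X : w ∈ X) → v ≢ w → Adj v w → colour v∈X ≢ colour w∈X

open Colouring

SDR : (Fin m → Subset c) → Subset m → Set
SDR = Colouring (λ _ _ → Unit)

module _ {Adj : Fin m → Fin m → Set} where

  SDR⇒Colouring : SDR L X → Colouring Adj L X
  SDR⇒Colouring s = record
    { colour  = colour s
    ; colour∈ = colour∈ s
    ; proper  = λ v∈X w∈X v≢w _ → proper s v∈X w∈X v≢w tt
    }

  Empty⇒Colouring : Empty X → Colouring Adj L X
  Empty⇒Colouring X-empty = record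
    { colour  = λ {v} v∈X → contradiction (v , v∈X) X-empty
    ; colour∈ = λ {v} v∈X → contradiction (v , v∈X) X-empty
    ; proper  = λ {v} v∈X → contradiction (v , v∈X) X-empty
    }

  monochromatic : ∀ {a} → (∀ {v} → v ∈ X → a ∈ L v) → (∀ {v w} → v ∈ X → w ∈ X → v ≢ w → ¬ Adj v w) →
                  Colouring Adj L X
  monochromatic {a = a} a∈L independent = record
    { colour  = λ _ → a
    ; colour∈ = a∈L
    ; proper  = λ v∈X w∈X v≢w adj _ → independent v∈X w∈X v≢w adj
    }

  join : (∀ {v} → v ∈ X → v ∈ Y ⊎ v ∈ Z) → (s : Colouring Adj L Y) (t : Colouring Adj L′ Z) →
         (∀ {v} → L′ v ⊆ L v) →
         (∀ {v w} (v∈Y : v ∈ Y) (w∈Z : w ∈ Z) → colour s v∈Y ≢ colour t w∈Z) →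
         Colouring Adj L X
  join {X = X} {Y = Y} {Z = Z} {L = L} {L′ = L′} split s t L′⊆L separated = record
    { colour  = λ v∈X → [ colour s , colour t ]′ (split v∈X)
    ; colour∈ = colour∈′
    ; proper  = proper′
    }
    where
    colour∈′ : (v∈X : v ∈ X) → [ colour s , colour t ]′ (split v∈X) ∈ L v
    colour∈′ v∈X with split v∈X
    ... | inj₁ v∈Y = colour∈ s v∈Y
    ... | inj₂ v∈Z = L′⊆L (colour∈ t v∈Z)

    proper′ : (v∈X : v ∈ X) (w∈X : w ∈ X) → v ≢ w → Adj v w →
              [ colour s , colour t ]′ (split v∈X) ≢ [ colour s , colour t ]′ (split w∈X)
    proper′ v∈X w∈X v≢w adj with split v∈X | split w∈X
    ... | inj₁ v∈Y | inj₁ w∈Y = proper s v∈Y w∈Y v≢w adj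
    ... | inj₁ v∈Y | inj₂ w∈Z = separated v∈Y w∈Z
    ... | inj₂ v∈Z | inj₁ w∈Y = ≢-sym (separated w∈Y v∈Z)
    ... | inj₂ v∈Z | inj₂ w∈Z = proper t v∈Z w∈Z v≢w adj

HallCondition : (Fin m → Subset c) → Subset m → Set
HallCondition L X = ∀ Y → Y ⊆ X → ∣ Y ∣ ≤ ∣ image L Y ∣

Critical : (Fin m → Subset c) → Subset m → Subset m → Set
Critical L X Y = Y ⊆ X × 0 < ∣ Y ∣ × ∣ Y ∣ < ∣ X ∣ × ∣ image L Y ∣ ≤ ∣ Y ∣

critical? : ∀ (L : Fin m → Subset c) X → Decidable (Critical L X)
critical? L X Y = Y ⊆? X ×-dec 0 <? ∣ Y ∣ ×-dec ∣ Y ∣ <? ∣ X ∣ ×-dec ∣ image L Y ∣ ≤? ∣ Y ∣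

HallUpTo : ℕ → Set
HallUpTo s = ∀ {m c} (L : Fin m → Subset c) X → ∣ X ∣ ≤ s → HallCondition L X → SDR L X

hall-critical : ∀ {s} (L : Fin m → Subset c) X Y → ∣ X ∣ ≤ suc s → HallCondition L X → Critical L X Y →
                HallUpTo s → SDR L X
hall-critical L X Y ∣X∣≤1+s hallX (Y⊆X , 0<∣Y∣ , ∣Y∣<∣X∣ , ∣LY∣≤∣Y∣) hall′ =
  join split sdrY sdrX─Y (p─q⊆p _ _) separated
  where
  X─Y : Subset _
  X─Y = X ─ Y

  L─Y : Fin _ → Subset _
  L─Y v = L v ─ image L Y

  ∣X─Y∣<∣X∣ : ∣ X─Y ∣ < ∣ X ∣
  ∣X─Y∣<∣X∣ with v , v∈Y ← 0<∣p∣⇒Nonempty 0<∣Y∣ = p∩q≢∅⇒∣p─q∣<∣p∣ X Y (v , x∈p∩q⁺ (Y⊆X v∈Y , v∈Y))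

  hallX─Y : HallCondition L─Y X─Y
  hallX─Y W W⊆X─Y = +-cancelʳ-≤ _ _ _ (begin
    ∣ W ∣ + ∣ Y ∣                        ≡⟨ Empty[p∩q]⇒∣p∪q∣≡∣p∣+∣q∣ W Y W∩Y-empty ⟨
    ∣ W ∪ Y ∣                            ≤⟨ hallX (W ∪ Y) W∪Y⊆X ⟩
    ∣ image L (W ∪ Y) ∣                  ≤⟨ p⊆q⇒∣p∣≤∣q∣ image⊆ ⟩
    ∣ image L─Y W ∪ image L Y ∣           ≤⟨ ∣p∪q∣≤∣p∣+∣q∣ (image L─Y W) (image L Y) ⟩
    ∣ image L─Y W ∣ + ∣ image L Y ∣       ≤⟨ +-monoʳ-≤ _ ∣LY∣≤∣Y∣ ⟩
    ∣ image L─Y W ∣ + ∣ Y ∣               ∎)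
    where
    open ≤-Reasoning
    W∩Y-empty : Empty (W ∩ Y)
    W∩Y-empty (v , v∈W∩Y) with v∈W , v∈Y ← x∈p∩q⁻ W Y v∈W∩Y = x∈p─q⇒x∉q X Y (W⊆X─Y v∈W) v∈Y
    W∪Y⊆X : W ∪ Y ⊆ X
    W∪Y⊆X v∈ with x∈p∪q⁻ W Y v∈
    ... | inj₁ v∈W = p─q⊆p X Y (W⊆X─Y v∈W)
    ... | inj₂ v∈Y = Y⊆X v∈Y
    image⊆ : image L (W ∪ Y) ⊆ image L─Y W ∪ image L Y
    image⊆ {a} a∈ with v , v∈W∪Y , a∈Lv ← ∈image⁻ L (W ∪ Y) a∈ | x∈p∪q⁻ W Y v∈W∪Y | a ∈? image L Y
    ... | _         | yes a∈LY = x∈p∪q⁺ (inj₂ a∈LY)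
    ... | inj₂ v∈Y  | no  _    = x∈p∪q⁺ (inj₂ (∈image⁺ {L = L} v∈Y a∈Lv))
    ... | inj₁ v∈W  | no a∉LY  = x∈p∪q⁺ (inj₁ (∈image⁺ {L = L─Y} v∈W (x∈p∧x∉q⇒x∈p─q a∈Lv a∉LY)))

  sdrY : SDR L Y
  sdrY = hall′ L Y (≤-pred (≤-trans ∣Y∣<∣X∣ ∣X∣≤1+s)) (λ W W⊆Y → hallX W (⊆-trans W⊆Y Y⊆X))

  sdrX─Y : SDR L─Y X─Y
  sdrX─Y = hall′ L─Y X─Y (≤-pred (≤-trans ∣X─Y∣<∣X∣ ∣X∣≤1+s)) hallX─Y

  split : ∀ {v} → v ∈ X → v ∈ Y ⊎ v ∈ X─Y
  split {v} v∈X with v ∈? Y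
  ... | yes v∈Y = inj₁ v∈Y
  ... | no  v∉Y = inj₂ (x∈p∧x∉q⇒x∈p─q v∈X v∉Y)

  separated : ∀ {v w} (v∈Y : v ∈ Y) (w∈X─Y : w ∈ X─Y) → colour sdrY v∈Y ≢ colour sdrX─Y w∈X─Y
  separated v∈Y w∈X─Y eq = x∈p─q⇒x∉q (L _) (image L Y) (colour∈ sdrX─Y w∈X─Y)
    (subst (_∈ image L Y) eq (∈image⁺ {L = L} v∈Y (colour∈ sdrY v∈Y)))

hall-noncritical : ∀ {s} (L : Fin m → Subset c) X → v ∈ X → ∣ X ∣ ≤ suc s → HallCondition L X →
                   (∀ Y → ¬ Critical L X Y) → HallUpTo s → SDR L X
hall-noncritical {v = v} L X v∈X ∣X∣≤1+s hallX noncritical hall′ =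
  join split sdr⁅v⁆ sdrX-v (p─q⊆p _ _) separated
  where
  ⁅v⁆⊆X : ⁅ v ⁆ ⊆ X
  ⁅v⁆⊆X w∈⁅v⁆ = subst (_∈ X) (sym (x∈⁅y⁆⇒x≡y v w∈⁅v⁆)) v∈X

  a∈Lv : ∃[ a ] a ∈ L v
  a∈Lv with a , a∈ ← 0<∣p∣⇒Nonempty (≤-trans (≤-reflexive (sym (∣⁅x⁆∣≡1 v))) (hallX ⁅ v ⁆ ⁅v⁆⊆X))
       with w , w∈⁅v⁆ , a∈Lw ← ∈image⁻ L ⁅ v ⁆ a∈ = a , subst (λ u → a ∈ L u) (x∈⁅y⁆⇒x≡y v w∈⁅v⁆) a∈Lw

  a : Fin _
  a = proj₁ a∈Lv

  L-a : Fin _ → Subset _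
  L-a w = L w - a

  hallX-v : HallCondition L-a (X - v)
  hallX-v W W⊆X-v with ∣ W ∣ ≟ℕ 0
  ... | yes ∣W∣≡0 = ≤-trans (≤-reflexive ∣W∣≡0) z≤n
  ... | no  ∣W∣≢0 = ≤-pred (begin-strict
    ∣ W ∣                   <⟨ ≰⇒> (λ ∣LW∣≤∣W∣ → noncritical W (W⊆X , n≢0⇒n>0 ∣W∣≢0 , ∣W∣<∣X∣ , ∣LW∣≤∣W∣)) ⟩
    ∣ image L W ∣           ≤⟨ ∣p∣≤1+∣p-x∣ (image L W) a ⟩
    suc ∣ image L W - a ∣   ≤⟨ s≤s (p⊆q⇒∣p∣≤∣q∣ image-a⊆) ⟩
    suc ∣ image L-a W ∣     ∎)
    where
    open ≤-Reasoning
    W⊆X : W ⊆ X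
    W⊆X = p─q⊆p _ _ ∘ W⊆X-v
    ∣W∣<∣X∣ : ∣ W ∣ < ∣ X ∣
    ∣W∣<∣X∣ = ≤-<-trans (p⊆q⇒∣p∣≤∣q∣ W⊆X-v) (x∈p⇒∣p-x∣<∣p∣ v∈X)
    image-a⊆ : image L W - a ⊆ image L-a W
    image-a⊆ b∈ with w , w∈W , b∈Lw ← ∈image⁻ L W (p─q⊆p _ _ b∈) =
      ∈image⁺ {L = L-a} w∈W (x∈p∧x∉q⇒x∈p─q b∈Lw (x∈p─q⇒x∉q _ _ b∈))

  sdr⁅v⁆ : SDR L ⁅ v ⁆
  sdr⁅v⁆ = monochromatic
    (λ w∈⁅v⁆ → subst (λ u → a ∈ L u) (sym (x∈⁅y⁆⇒x≡y v w∈⁅v⁆)) (proj₂ a∈Lv))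
    (λ u∈⁅v⁆ w∈⁅v⁆ u≢w _ → u≢w (trans (x∈⁅y⁆⇒x≡y v u∈⁅v⁆) (sym (x∈⁅y⁆⇒x≡y v w∈⁅v⁆))))

  sdrX-v : SDR L-a (X - v)
  sdrX-v = hall′ L-a (X - v) (≤-pred (≤-trans (x∈p⇒∣p-x∣<∣p∣ v∈X) ∣X∣≤1+s)) hallX-v

  split : ∀ {w} → w ∈ X → w ∈ ⁅ v ⁆ ⊎ w ∈ X - v
  split {w} w∈X with w ≟ v
  ... | yes refl = inj₁ (x∈⁅x⁆ v)
  ... | no  w≢v  = inj₂ (x∈p∧x≢y⇒x∈p-y w∈X w≢v)

  separated : ∀ {u w} (u∈⁅v⁆ : u ∈ ⁅ v ⁆) (w∈X-v : w ∈ X - v) → colour sdr⁅v⁆ u∈⁅v⁆ ≢ colour sdrX-v w∈X-v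
  separated _ w∈X-v eq = x∈p-y⇒x≢y (L _) (colour∈ sdrX-v w∈X-v) (sym eq)

hall′ : ∀ s → HallUpTo s
hall′ zero    L X ∣X∣≤0 _ = Empty⇒Colouring (λ (_ , v∈X) → <⇒≱ (x∈p⇒0<∣p∣ v∈X) ∣X∣≤0)
hall′ (suc s) L X ∣X∣≤1+s hallX with nonempty? X | anySubset? (critical? L X)
... | no  X-empty   | _               = Empty⇒Colouring X-empty
... | yes _         | yes (Y , crit)  = hall-critical L X Y ∣X∣≤1+s hallX crit (hall′ s)
... | yes (v , v∈X) | no  noncritical =
  hall-noncritical L X v∈X ∣X∣≤1+s hallX (λ Y → noncritical ∘ (Y ,_)) (hall′ s)

hall : ∀ (L : Fin m → Subset c) X → HallCondition L X → SDR L X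
hall L X = hall′ ∣ X ∣ L X ≤-refl

cover : List (Fin m × Fin m) → Subset m
cover []            = ⊥
cover ((e , f) ∷ P) = ⁅ e ⁆ ∪ ⁅ f ⁆ ∪ cover P

IsMatching : List (Fin m × Fin m) → Set
IsMatching []            = Unit
IsMatching ((e , f) ∷ P) = e ≢ f × e ∉ cover P × f ∉ cover P × IsMatching P

∈cover-∷⁺ : ∀ {e f} P → v ≡ e ⊎ v ≡ f ⊎ v ∈ cover P → v ∈ cover ((e , f) ∷ P)
∈cover-∷⁺ P (inj₁ refl)        = x∈p∪q⁺ (inj₁ (x∈⁅x⁆ _))
∈cover-∷⁺ P (inj₂ (inj₁ refl)) = x∈p∪q⁺ (inj₂ (x∈p∪q⁺ (inj₁ (x∈⁅x⁆ _))))
∈cover-∷⁺ P (inj₂ (inj₂ v∈P))  = x∈p∪q⁺ (inj₂ (x∈p∪q⁺ (inj₂ v∈P)))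

∈cover-∷⁻ : ∀ e f P → v ∈ cover ((e , f) ∷ P) → v ≡ e ⊎ v ≡ f ⊎ v ∈ cover P
∈cover-∷⁻ e f P v∈ with x∈p∪q⁻ ⁅ e ⁆ _ v∈
... | inj₁ v∈⁅e⁆ = inj₁ (x∈⁅y⁆⇒x≡y e v∈⁅e⁆)
... | inj₂ v∈′ with x∈p∪q⁻ ⁅ f ⁆ _ v∈′
...   | inj₁ v∈⁅f⁆ = inj₂ (inj₁ (x∈⁅y⁆⇒x≡y f v∈⁅f⁆))
...   | inj₂ v∈P   = inj₂ (inj₂ v∈P)

∈cover⁺ : ∀ {e f} → (e , f) List.∈ P → e ∈ cover P × f ∈ cover P
∈cover⁺ {P = _ ∷ P} (here refl) = ∈cover-∷⁺ P (inj₁ refl) , ∈cover-∷⁺ P (inj₂ (inj₁ refl))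
∈cover⁺ {P = _ ∷ P} (there q∈P) with e∈ , f∈ ← ∈cover⁺ q∈P =
  ∈cover-∷⁺ P (inj₂ (inj₂ e∈)) , ∈cover-∷⁺ P (inj₂ (inj₂ f∈))

∈cover⁻ : ∀ P → v ∈ cover P → ∃[ e ] ∃[ f ] (e , f) List.∈ P × (v ≡ e ⊎ v ≡ f)
∈cover⁻ []            v∈ = contradiction v∈ ∉⊥
∈cover⁻ ((e , f) ∷ P) v∈ with ∈cover-∷⁻ e f P v∈
... | inj₁ v≡e        = e , f , here refl , inj₁ v≡e
... | inj₂ (inj₁ v≡f) = e , f , here refl , inj₂ v≡f
... | inj₂ (inj₂ v∈P) with e′ , f′ , q∈P , v≡ ← ∈cover⁻ P v∈P = e′ , f′ , there q∈P , v≡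

∣cover∣≡2*length : ∀ (P : List (Fin m × Fin m)) → IsMatching P → ∣ cover P ∣ ≡ length P + length P
∣cover∣≡2*length {m} []            _                       = ∣⊥∣≡0 m
∣cover∣≡2*length     ((e , f) ∷ P) (e≢f , e∉P , f∉P , matching) = begin
  ∣ ⁅ e ⁆ ∪ ⁅ f ⁆ ∪ cover P ∣      ≡⟨ Empty[p∩q]⇒∣p∪q∣≡∣p∣+∣q∣ ⁅ e ⁆ _ e-apart ⟩
  ∣ ⁅ e ⁆ ∣ + ∣ ⁅ f ⁆ ∪ cover P ∣  ≡⟨ cong₂ _+_ (∣⁅x⁆∣≡1 e) (Empty[p∩q]⇒∣p∪q∣≡∣p∣+∣q∣ ⁅ f ⁆ _ f-apart) ⟩
  1 + (∣ ⁅ f ⁆ ∣ + ∣ cover P ∣)    ≡⟨ cong₂ (λ a b → 1 + (a + b)) (∣⁅x⁆∣≡1 f) (∣cover∣≡2*length P matching) ⟩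
  suc (suc (length P + length P))  ≡⟨ cong suc (+-suc (length P) (length P)) ⟨
  suc (length P + suc (length P))  ∎
  where
  open ≡-Reasoning
  e-apart : Empty (⁅ e ⁆ ∩ (⁅ f ⁆ ∪ cover P))
  e-apart (v , v∈) with v∈⁅e⁆ , v∈′ ← x∈p∩q⁻ ⁅ e ⁆ _ v∈ with refl ← x∈⁅y⁆⇒x≡y e v∈⁅e⁆ with x∈p∪q⁻ ⁅ f ⁆ _ v∈′
  ... | inj₁ v∈⁅f⁆ = e≢f (x∈⁅y⁆⇒x≡y f v∈⁅f⁆)
  ... | inj₂ v∈P   = e∉P v∈P
  f-apart : Empty (⁅ f ⁆ ∩ cover P)
  f-apart (v , v∈) with v∈⁅f⁆ , v∈P ← x∈p∩q⁻ ⁅ f ⁆ _ v∈ with refl ← x∈⁅y⁆⇒x≡y f v∈⁅f⁆ = f∉P v∈P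

∣p∩cover∣≤length : ∀ (Y : Subset m) P → (∀ {e f} → (e , f) List.∈ P → e ∉ Y ⊎ f ∉ Y) →
                   ∣ Y ∩ cover P ∣ ≤ length P
∣p∩cover∣≤length {m} Y []            _       = ≤-reflexive (trans (cong ∣_∣ (∩-zeroʳ Y)) (∣⊥∣≡0 m))
∣p∩cover∣≤length     Y ((e , f) ∷ P) missing = begin
  ∣ Y ∩ cover ((e , f) ∷ P) ∣        ≤⟨ p⊆q⇒∣p∣≤∣q∣ Y∩cover⊆ ⟩
  ∣ ⁅ g ⁆ ∪ (Y ∩ cover P) ∣          ≤⟨ ∣p∪q∣≤∣p∣+∣q∣ ⁅ g ⁆ _ ⟩
  ∣ ⁅ g ⁆ ∣ + ∣ Y ∩ cover P ∣        ≡⟨ cong (_+ ∣ Y ∩ cover P ∣) (∣⁅x⁆∣≡1 g) ⟩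
  suc ∣ Y ∩ cover P ∣                ≤⟨ s≤s (∣p∩cover∣≤length Y P (missing ∘ there)) ⟩
  suc (length P)                     ∎
  where
  open ≤-Reasoning
  g : Fin _
  g with missing (here refl)
  ... | inj₁ _ = f
  ... | inj₂ _ = e
  Y∩cover⊆ : Y ∩ cover ((e , f) ∷ P) ⊆ ⁅ g ⁆ ∪ (Y ∩ cover P)
  Y∩cover⊆ v∈ with v∈Y , v∈cover ← x∈p∩q⁻ Y _ v∈ with missing (here refl) | ∈cover-∷⁻ e f P v∈cover
  ... | _        | inj₂ (inj₂ v∈P) = x∈p∪q⁺ (inj₂ (x∈p∩q⁺ (v∈Y , v∈P)))
  ... | inj₁ e∉Y | inj₁ refl        = contradiction v∈Y e∉Y
  ... | inj₁ e∉Y | inj₂ (inj₁ refl) = x∈p∪q⁺ (inj₁ (x∈⁅x⁆ f))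
  ... | inj₂ f∉Y | inj₁ refl        = x∈p∪q⁺ (inj₁ (x∈⁅x⁆ e))
  ... | inj₂ f∉Y | inj₂ (inj₁ refl) = contradiction v∈Y f∉Y

record PairRemoval (P : List (Fin m × Fin m)) (x : Fin m) : Set where
  field
    rest          : List (Fin m × Fin m)
    length-rest   : length P ≡ suc (length rest)
    rest-matching : IsMatching rest
    rest⊆         : ∀ {q} → q List.∈ rest → q List.∈ P
    cover-rest⊆   : cover rest ⊆ cover P - x

dropFirst : ∀ {e f} P → IsMatching P → v ∉ cover P → PairRemoval ((e , f) ∷ P) v
dropFirst P matching v∉P = record
  { rest          = P
  ; length-rest   = refl
  ; rest-matching = matching
  ; rest⊆         = there
  ; cover-rest⊆   = λ w∈ → x∈p∧x≢y⇒x∈p-y (∈cover-∷⁺ P (inj₂ (inj₂ w∈))) (λ { refl → v∉P w∈ })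
  }

removePair : ∀ P → IsMatching P → v ∈ cover P → PairRemoval P v
removePair []            _ x∈ = contradiction x∈ ∉⊥
removePair {v = x} ((e , f) ∷ P) (e≢f , e∉P , f∉P , matching) x∈ with ∈cover-∷⁻ e f P x∈
... | inj₁ refl        = dropFirst P matching e∉P
... | inj₂ (inj₁ refl) = dropFirst P matching f∉P
... | inj₂ (inj₂ x∈P) = record
  { rest          = (e , f) ∷ rest
  ; length-rest   = cong suc length-rest
  ; rest-matching = e≢f , e∉P ∘ removed⊆ , f∉P ∘ removed⊆ , rest-matching
  ; rest⊆         = λ { (here refl) → here refl ; (there q∈) → there (rest⊆ q∈) }
  ; cover-rest⊆   = cover-rest⊆′
  }
  where
  open PairRemoval (removePair P matching x∈P)
  removed⊆ : cover rest ⊆ cover P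
  removed⊆ = p─q⊆p _ _ ∘ cover-rest⊆
  cover-rest⊆′ : cover ((e , f) ∷ rest) ⊆ cover ((e , f) ∷ P) - x
  cover-rest⊆′ v∈ with ∈cover-∷⁻ e f rest v∈
  ... | inj₁ refl        = x∈p∧x≢y⇒x∈p-y (∈cover-∷⁺ P (inj₁ refl)) (λ { refl → e∉P x∈P })
  ... | inj₂ (inj₁ refl) = x∈p∧x≢y⇒x∈p-y (∈cover-∷⁺ P (inj₂ (inj₁ refl))) (λ { refl → f∉P x∈P })
  ... | inj₂ (inj₂ v∈)   =
    x∈p∧x≢y⇒x∈p-y (∈cover-∷⁺ P (inj₂ (inj₂ (removed⊆ v∈)))) (x∈p-y⇒x≢y _ (cover-rest⊆ v∈))

Adjacent : (Fin m → Subset m) → Fin m → Fin m → Set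
Adjacent N v w = w ∈ N v

SymmetricAdjacency : (Fin m → Subset m) → Set
SymmetricAdjacency N = ∀ {v w} → w ∈ N v → v ∈ N w

module _ {m c : ℕ} (N : Fin m → Subset m) where

  record Invariant (L : Fin m → Subset c) (S : Subset m) (k : ℕ) (P : List (Fin m × Fin m)) : Set where
    field
      lists-large  : ∀ {v} → v ∈ S → k ≤ ∣ L v ∣
      S-small      : ∣ S ∣ ≤ k + length P
      P-short      : length P ≤ k
      matching     : IsMatching P
      cover⊆S      : cover P ⊆ S
      cover-clique : ∀ {v w} → v ∈ cover P → w ∈ cover P → v ≢ w → w ∈ N v
      sparse       : ∀ {e f} → (e , f) List.∈ P → ∣ N e ∩ N f ∩ S ∣ + 2 ≤ k

  record SharedColourNonEdge (L : Fin m → Subset c) (S : Subset m) (P : List (Fin m × Fin m))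
                             (x y : Fin m) (a : Fin c) : Set where
    constructor sharedColourNonEdge
    field
      x∈cover : x ∈ cover P
      y∈S     : y ∈ S
      y≢x     : y ≢ x
      y∉Nx    : y ∉ N x
      a∈Lx    : a ∈ L x
      a∈Ly    : a ∈ L y

  module _ {L : Fin m → Subset c} {S : Subset m} {k : ℕ} {P : List (Fin m × Fin m)}
           (inv : Invariant L S k P) where
    open Invariant inv

    private
      C : Subset m
      C = cover P

    ∣Y∣≤k⇒hall : ∀ Y → Y ⊆ S → ∣ Y ∣ ≤ k → ∣ Y ∣ ≤ ∣ image L Y ∣
    ∣Y∣≤k⇒hall Y Y⊆S ∣Y∣≤k with ∣ Y ∣ ≟ℕ 0
    ... | yes ∣Y∣≡0 = ≤-trans (≤-reflexive ∣Y∣≡0) z≤n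
    ... | no  ∣Y∣≢0 with v , v∈Y ← 0<∣p∣⇒Nonempty (n≢0⇒n>0 ∣Y∣≢0) =
      ≤-trans ∣Y∣≤k (≤-trans (lists-large (Y⊆S v∈Y)) (p⊆q⇒∣p∣≤∣q∣ (∈image⁺ {L = L} v∈Y)))

    nonEdge⇒hall : (∀ x y a → ¬ SharedColourNonEdge L S P x y a) →
                   ∀ {x y} Y → Y ⊆ S → x ∈ Y → x ∈ C → y ∈ Y → y ≢ x → y ∉ N x → ∣ Y ∣ ≤ ∣ image L Y ∣
    nonEdge⇒hall noShared {x} {y} Y Y⊆S x∈Y x∈C y∈Y y≢x y∉Nx = begin
      ∣ Y ∣                    ≤⟨ p⊆q⇒∣p∣≤∣q∣ Y⊆S ⟩
      ∣ S ∣                    ≤⟨ S-small ⟩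
      k + length P             ≤⟨ +-mono-≤ (lists-large (Y⊆S x∈Y)) (≤-trans P-short (lists-large (Y⊆S y∈Y))) ⟩
      ∣ L x ∣ + ∣ L y ∣        ≡⟨ Empty[p∩q]⇒∣p∪q∣≡∣p∣+∣q∣ (L x) (L y) Lx∩Ly-empty ⟨
      ∣ L x ∪ L y ∣            ≤⟨ p⊆q⇒∣p∣≤∣q∣ Lx∪Ly⊆ ⟩
      ∣ image L Y ∣            ∎
      where
      open ≤-Reasoning
      Lx∩Ly-empty : Empty (L x ∩ L y)
      Lx∩Ly-empty (a , a∈) with a∈Lx , a∈Ly ← x∈p∩q⁻ (L x) (L y) a∈ =
        noShared x y a (sharedColourNonEdge x∈C (Y⊆S y∈Y) y≢x y∉Nx a∈Lx a∈Ly)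
      Lx∪Ly⊆ : L x ∪ L y ⊆ image L Y
      Lx∪Ly⊆ a∈ with x∈p∪q⁻ (L x) (L y) a∈
      ... | inj₁ a∈Lx = ∈image⁺ {L = L} x∈Y a∈Lx
      ... | inj₂ a∈Ly = ∈image⁺ {L = L} y∈Y a∈Ly

    pair⊆Y⇒∣Y∣≤k : ∀ {e f} Y → Y ⊆ S → (e , f) List.∈ P →
                 (∀ {y} → y ∈ Y → y ≢ e → y ∈ N e) → (∀ {y} → y ∈ Y → y ≢ f → y ∈ N f) → ∣ Y ∣ ≤ k
    pair⊆Y⇒∣Y∣≤k {e} {f} Y Y⊆S ef∈P e-adj f-adj = begin
      ∣ Y ∣                                     ≤⟨ p⊆q⇒∣p∣≤∣q∣ Y⊆ ⟩
      ∣ ⁅ e ⁆ ∪ ⁅ f ⁆ ∪ N e ∩ N f ∩ S ∣         ≤⟨ ∣p∪q∣≤∣p∣+∣q∣ ⁅ e ⁆ _ ⟩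
      ∣ ⁅ e ⁆ ∣ + ∣ ⁅ f ⁆ ∪ N e ∩ N f ∩ S ∣     ≤⟨ +-monoʳ-≤ ∣ ⁅ e ⁆ ∣ (∣p∪q∣≤∣p∣+∣q∣ ⁅ f ⁆ _) ⟩
      ∣ ⁅ e ⁆ ∣ + (∣ ⁅ f ⁆ ∣ + ∣ N e ∩ N f ∩ S ∣)
        ≡⟨ cong₂ (λ a b → a + (b + ∣ N e ∩ N f ∩ S ∣)) (∣⁅x⁆∣≡1 e) (∣⁅x⁆∣≡1 f) ⟩
      2 + ∣ N e ∩ N f ∩ S ∣                      ≡⟨ +-comm 2 _ ⟩
      ∣ N e ∩ N f ∩ S ∣ + 2                      ≤⟨ sparse ef∈P ⟩
      k                                          ∎
      where
      open ≤-Reasoning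
      Y⊆ : Y ⊆ ⁅ e ⁆ ∪ ⁅ f ⁆ ∪ N e ∩ N f ∩ S
      Y⊆ {y} y∈Y with y ≟ e | y ≟ f
      ... | yes refl | _        = x∈p∪q⁺ (inj₁ (x∈⁅x⁆ e))
      ... | no  _    | yes refl = x∈p∪q⁺ (inj₂ (x∈p∪q⁺ (inj₁ (x∈⁅x⁆ f))))
      ... | no  y≢e  | no  y≢f  =
        x∈p∪q⁺ (inj₂ (x∈p∪q⁺ (inj₂ (x∈p∩q⁺ (e-adj y∈Y y≢e , x∈p∩q⁺ (f-adj y∈Y y≢f , Y⊆S y∈Y))))))

    transversal⇒∣Y∣≤k : ∀ Y → Y ⊆ S → (∀ {e f} → (e , f) List.∈ P → e ∉ Y ⊎ f ∉ Y) → ∣ Y ∣ ≤ k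
    transversal⇒∣Y∣≤k Y Y⊆S missing = +-cancelʳ-≤ _ _ _ (begin
      ∣ Y ∣ + length P                              ≡⟨ cong (_+ length P) (∣p∣≡∣p∩q∣+∣p─q∣ Y C) ⟩
      ∣ Y ∩ C ∣ + ∣ Y ─ C ∣ + length P
        ≤⟨ +-monoˡ-≤ (length P) (+-mono-≤ (∣p∩cover∣≤length Y P missing) (p⊆q⇒∣p∣≤∣q∣ Y─C⊆S─C)) ⟩
      length P + ∣ S ─ C ∣ + length P               ≡⟨ +-assoc (length P) _ _ ⟩
      length P + (∣ S ─ C ∣ + length P)             ≡⟨ cong (length P +_) (+-comm _ (length P)) ⟩
      length P + (length P + ∣ S ─ C ∣)             ≡⟨ +-assoc (length P) _ _ ⟨
      length P + length P + ∣ S ─ C ∣               ≡⟨ cong (_+ ∣ S ─ C ∣) (∣cover∣≡2*length P matching) ⟨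
      ∣ C ∣ + ∣ S ─ C ∣
        ≤⟨ +-monoˡ-≤ _ (p⊆q⇒∣p∣≤∣q∣ (λ v∈C → x∈p∩q⁺ (cover⊆S v∈C , v∈C))) ⟩
      ∣ S ∩ C ∣ + ∣ S ─ C ∣                         ≡⟨ ∣p∣≡∣p∩q∣+∣p─q∣ S C ⟨
      ∣ S ∣                                         ≤⟨ S-small ⟩
      k + length P                                  ∎)
      where
      open ≤-Reasoning
      Y─C⊆S─C : Y ─ C ⊆ S ─ C
      Y─C⊆S─C v∈ = x∈p∧x∉q⇒x∈p─q (Y⊆S (p─q⊆p Y C v∈)) (x∈p─q⇒x∉q Y C v∈)

    hallCondition : (∀ x y a → ¬ SharedColourNonEdge L S P x y a) → HallCondition L S
    hallCondition noShared Y Y⊆S with ∣ Y ∣ ≤? k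
    ... | yes ∣Y∣≤k = ∣Y∣≤k⇒hall Y Y⊆S ∣Y∣≤k
    ... | no  ∣Y∣≰k
      with any? (λ x → any? (λ y → x ∈? Y ×-dec x ∈? C ×-dec y ∈? Y ×-dec ¬? (y ≟ x) ×-dec ¬? (y ∈? N x)))
    ...   | yes (x , y , x∈Y , x∈C , y∈Y , y≢x , y∉Nx) = nonEdge⇒hall noShared Y Y⊆S x∈Y x∈C y∈Y y≢x y∉Nx
    ...   | no  noNonEdge = contradiction ∣Y∣≤k ∣Y∣≰k
      where
      adjacent : ∀ {x y} → x ∈ Y → x ∈ C → y ∈ Y → y ≢ x → y ∈ N x
      adjacent {x} {y} x∈Y x∈C y∈Y y≢x with y ∈? N x
      ... | yes y∈Nx = y∈Nx
      ... | no  y∉Nx = contradiction (x , y , x∈Y , x∈C , y∈Y , y≢x , y∉Nx) noNonEdge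
      ∣Y∣≤k : ∣ Y ∣ ≤ k
      ∣Y∣≤k with Any.any? (λ q → proj₁ q ∈? Y ×-dec proj₂ q ∈? Y) P
      ... | yes pairInY with (e , f) , ef∈P , e∈Y , f∈Y ← find pairInY
          with e∈C , f∈C ← ∈cover⁺ ef∈P =
        pair⊆Y⇒∣Y∣≤k Y Y⊆S ef∈P (adjacent e∈Y e∈C) (adjacent f∈Y f∈C)
      ... | no  noPairInY = transversal⇒∣Y∣≤k Y Y⊆S missing
        where
        missing : ∀ {e f} → (e , f) List.∈ P → e ∉ Y ⊎ f ∉ Y
        missing {e} {f} ef∈P with e ∈? Y | f ∈? Y
        ... | no  e∉Y | _       = inj₁ e∉Y
        ... | yes _   | no  f∉Y = inj₂ f∉Y
        ... | yes e∈Y | yes f∈Y = contradiction (lose ef∈P (e∈Y , f∈Y)) noPairInY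

  module _ {L : Fin m → Subset c} {S : Subset m} {k : ℕ} {P : List (Fin m × Fin m)} {x y : Fin m} {a : Fin c}
           (inv : Invariant L S (suc k) P)
           (shared : SharedColourNonEdge L S P x y a) where
    open Invariant inv
    open SharedColourNonEdge shared
    open PairRemoval (removePair P matching x∈cover)

    private
      L-a : Fin m → Subset c
      L-a v = L v - a

    ∣S-x-y∣+2≤∣S∣ : ∣ S - x - y ∣ + 2 ≤ ∣ S ∣
    ∣S-x-y∣+2≤∣S∣ = begin
      ∣ S - x - y ∣ + 2       ≡⟨ +-comm _ 2 ⟩
      suc (suc ∣ S - x - y ∣) ≤⟨ s≤s (x∈p⇒∣p-x∣<∣p∣ (x∈p∧x≢y⇒x∈p-y y∈S y≢x)) ⟩
      suc ∣ S - x ∣           ≤⟨ x∈p⇒∣p-x∣<∣p∣ (cover⊆S x∈cover) ⟩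
      ∣ S ∣                   ∎
      where open ≤-Reasoning

    ∣S-x-y∣<∣S∣ : ∣ S - x - y ∣ < ∣ S ∣
    ∣S-x-y∣<∣S∣ = <-≤-trans (m<m+n _ (s≤s z≤n)) ∣S-x-y∣+2≤∣S∣

    invariant-step : Invariant L-a (S - x - y) k rest
    invariant-step = record
      { lists-large  = λ v∈ → ≤-pred (≤-trans (lists-large (p─q⊆p _ _ (p─q⊆p _ _ v∈))) (∣p∣≤1+∣p-x∣ (L _) a))
      ; S-small      = ≤-pred (≤-pred (begin
          suc (suc ∣ S - x - y ∣)      ≡⟨ +-comm 2 _ ⟩
          ∣ S - x - y ∣ + 2            ≤⟨ ∣S-x-y∣+2≤∣S∣ ⟩
          ∣ S ∣                        ≤⟨ S-small ⟩
          suc k + length P             ≡⟨ cong (suc k +_) length-rest ⟩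
          suc k + suc (length rest)    ≡⟨ cong suc (+-suc k _) ⟩
          suc (suc (k + length rest))  ∎))
      ; P-short      = ≤-pred (subst (_≤ suc k) length-rest P-short)
      ; matching     = rest-matching
      ; cover⊆S      = rest-cover⊆S
      ; cover-clique = λ v∈ w∈ → cover-clique (rest⊆C v∈) (rest⊆C w∈)
      ; sparse       = rest-sparse
      }
      where
      open ≤-Reasoning
      rest⊆C : cover rest ⊆ cover P
      rest⊆C = p─q⊆p _ _ ∘ cover-rest⊆
      rest-cover⊆S : cover rest ⊆ S - x - y
      rest-cover⊆S {v} v∈ =
        x∈p∧x≢y⇒x∈p-y (x∈p∧x≢y⇒x∈p-y (cover⊆S (rest⊆C v∈)) (x∈p-y⇒x≢y _ (cover-rest⊆ v∈))) v≢y
        where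
        v≢y : v ≢ y
        v≢y refl = y∉Nx (cover-clique x∈cover (rest⊆C v∈) (y≢x ∘ sym))
      rest-sparse : ∀ {e f} → (e , f) List.∈ rest → ∣ N e ∩ N f ∩ (S - x - y) ∣ + 2 ≤ k
      rest-sparse {e} {f} ef∈rest with e∈rest , f∈rest ← ∈cover⁺ ef∈rest = ≤-pred (begin
        suc (∣ N e ∩ N f ∩ (S - x - y) ∣ + 2) ≤⟨ +-monoˡ-≤ 2 (s≤s (p⊆q⇒∣p∣≤∣q∣ common⊆)) ⟩
        suc ∣ N e ∩ N f ∩ S - x ∣ + 2          ≤⟨ +-monoˡ-≤ 2 (x∈p⇒∣p-x∣<∣p∣ x∈common) ⟩
        ∣ N e ∩ N f ∩ S ∣ + 2                  ≤⟨ sparse (rest⊆ ef∈rest) ⟩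
        suc k                                  ∎)
        where
        x∈N : ∀ {g} → g ∈ cover rest → x ∈ N g
        x∈N g∈ = cover-clique (rest⊆C g∈) x∈cover (λ g≡x → x∈p-y⇒x≢y _ (cover-rest⊆ g∈) g≡x)
        x∈common : x ∈ N e ∩ N f ∩ S
        x∈common = x∈p∩q⁺ (x∈N e∈rest , x∈p∩q⁺ (x∈N f∈rest , cover⊆S x∈cover))
        common⊆ : N e ∩ N f ∩ (S - x - y) ⊆ N e ∩ N f ∩ S - x
        common⊆ {v} v∈ with v∈Ne , v∈′ ← x∈p∩q⁻ (N e) _ v∈ with v∈Nf , v∈S-x-y ← x∈p∩q⁻ (N f) _ v∈′ =
          x∈p∧x≢y⇒x∈p-y (x∈p∩q⁺ (v∈Ne , x∈p∩q⁺ (v∈Nf , p─q⊆p _ _ v∈S-x))) (x∈p-y⇒x≢y S v∈S-x)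
          where
          v∈S-x : v ∈ S - x
          v∈S-x = p─q⊆p _ _ v∈S-x-y

    colouring-step : SymmetricAdjacency N → Colouring (Adjacent N) L-a (S - x - y) →
                     Colouring (Adjacent N) L S
    colouring-step N-sym col = join split pairColouring col (p─q⊆p _ _) separated
      where
      x-or-y : ∀ {v} → v ∈ ⁅ x ⁆ ∪ ⁅ y ⁆ → v ≡ x ⊎ v ≡ y
      x-or-y v∈ with x∈p∪q⁻ ⁅ x ⁆ ⁅ y ⁆ v∈
      ... | inj₁ v∈⁅x⁆ = inj₁ (x∈⁅y⁆⇒x≡y x v∈⁅x⁆)
      ... | inj₂ v∈⁅y⁆ = inj₂ (x∈⁅y⁆⇒x≡y y v∈⁅y⁆)

      pairColouring : Colouring (Adjacent N) L (⁅ x ⁆ ∪ ⁅ y ⁆)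
      pairColouring = monochromatic a∈L independent
        where
        a∈L : ∀ {v} → v ∈ ⁅ x ⁆ ∪ ⁅ y ⁆ → a ∈ L v
        a∈L v∈ with x-or-y v∈
        ... | inj₁ refl = a∈Lx
        ... | inj₂ refl = a∈Ly
        independent : ∀ {v w} → v ∈ ⁅ x ⁆ ∪ ⁅ y ⁆ → w ∈ ⁅ x ⁆ ∪ ⁅ y ⁆ → v ≢ w → ¬ Adjacent N v w
        independent v∈ w∈ v≢w with x-or-y v∈ | x-or-y w∈
        ... | inj₁ refl | inj₁ refl = contradiction refl v≢w
        ... | inj₁ refl | inj₂ refl = y∉Nx
        ... | inj₂ refl | inj₁ refl = y∉Nx ∘ N-sym
        ... | inj₂ refl | inj₂ refl = contradiction refl v≢w

      split : ∀ {v} → v ∈ S → v ∈ ⁅ x ⁆ ∪ ⁅ y ⁆ ⊎ v ∈ S - x - y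
      split {v} v∈S with v ≟ x | v ≟ y
      ... | yes refl | _        = inj₁ (x∈p∪q⁺ (inj₁ (x∈⁅x⁆ x)))
      ... | no  _    | yes refl = inj₁ (x∈p∪q⁺ (inj₂ (x∈⁅x⁆ y)))
      ... | no  v≢x  | no  v≢y  = inj₂ (x∈p∧x≢y⇒x∈p-y (x∈p∧x≢y⇒x∈p-y v∈S v≢x) v≢y)

      separated : ∀ {v w} (v∈ : v ∈ ⁅ x ⁆ ∪ ⁅ y ⁆) (w∈ : w ∈ S - x - y) →
                  Colouring.colour pairColouring v∈ ≢ Colouring.colour col w∈
      separated _ w∈ a≡ = x∈p-y⇒x≢y (L _) (Colouring.colour∈ col w∈) (sym a≡)

  shared? : ∀ L S P x y a → Dec (SharedColourNonEdge L S P x y a)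
  shared? L S P x y a = map′
    (λ (x∈ , y∈ , y≢x , y∉Nx , a∈Lx , a∈Ly) → sharedColourNonEdge x∈ y∈ y≢x y∉Nx a∈Lx a∈Ly)
    (λ (sharedColourNonEdge x∈ y∈ y≢x y∉Nx a∈Lx a∈Ly) → x∈ , y∈ , y≢x , y∉Nx , a∈Lx , a∈Ly)
    (x ∈? cover P ×-dec y ∈? S ×-dec ¬? (y ≟ x) ×-dec ¬? (y ∈? N x) ×-dec a ∈? L x ×-dec a ∈? L y)

  no-cover-without-colours : ∀ {L S P v} → Invariant L S 0 P → v ∉ cover P
  no-cover-without-colours {P = []}    _   = ∉⊥
  no-cover-without-colours {P = _ ∷ _} inv = contradiction (Invariant.P-short inv) λ ()

  colourable′ : SymmetricAdjacency N → ∀ s {L S k P} → ∣ S ∣ ≤ s → Invariant L S k P →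
                Colouring (Adjacent N) L S
  colourable′ N-sym s {L} {S} {k} {P} ∣S∣≤s inv
    with any? (λ x → any? (λ y → any? (λ a → shared? L S P x y a)))
  ... | no none = SDR⇒Colouring (hall L S (hallCondition inv (λ x y a sh → none (x , y , a , sh))))
  ... | yes (_ , _ , _ , sh) = step s k ∣S∣≤s inv sh
    where
    step : ∀ s k {x y a} → ∣ S ∣ ≤ s → Invariant L S k P → SharedColourNonEdge L S P x y a →
           Colouring (Adjacent N) L S
    step _       zero    _     inv sh = contradiction (SharedColourNonEdge.x∈cover sh) (no-cover-without-colours inv)
    step zero    (suc k) ∣S∣≤0 _   sh = contradiction ∣S∣≤0 (<⇒≱ (x∈p⇒0<∣p∣ (SharedColourNonEdge.y∈S sh)))
    step (suc s) (suc k) ∣S∣≤s inv sh = colouring-step inv sh N-sym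
      (colourable′ N-sym s (≤-pred (≤-trans (∣S-x-y∣<∣S∣ inv sh) ∣S∣≤s)) (invariant-step inv sh))

  colourable : SymmetricAdjacency N → ∀ {L S k P} → Invariant L S k P → Colouring (Adjacent N) L S
  colourable N-sym {S = S} = colourable′ N-sym ∣ S ∣ ≤-refl

module _ (B : ℕ) where

  members : List ℕ → Subset B
  members xs = tabulate (λ a → isYes (toℕ a ∈ℕ? xs))

  ∈members⁺ : ∀ {a xs} → toℕ a List.∈ xs → a ∈ members xs
  ∈members⁺ a∈xs = ∈tabulate⁺ (fromWitness a∈xs)

  ∈members⁻ : ∀ {a xs} → a ∈ members xs → toℕ a List.∈ xs
  ∈members⁻ a∈ = toWitness (∈tabulate⁻ a∈)

  length≤∣members∣ : ∀ {xs} → Unique xs → All (_< B) xs → length xs ≤ ∣ members xs ∣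
  length≤∣members∣ {[]}      []             []           = z≤n
  length≤∣members∣ {x ∷ xs} (x∉xs ∷ unique) (x<B ∷ xs<B) = begin
    suc (length xs)                      ≤⟨ s≤s (length≤∣members∣ unique xs<B) ⟩
    suc ∣ members xs ∣                    ≡⟨ cong (_+ ∣ members xs ∣) (∣⁅x⁆∣≡1 a) ⟨
    ∣ ⁅ a ⁆ ∣ + ∣ members xs ∣            ≡⟨ Empty[p∩q]⇒∣p∪q∣≡∣p∣+∣q∣ ⁅ a ⁆ (members xs) apart ⟨
    ∣ ⁅ a ⁆ ∪ members xs ∣                ≤⟨ p⊆q⇒∣p∣≤∣q∣ ⊆members ⟩
    ∣ members (x ∷ xs) ∣                  ∎
    where
    open ≤-Reasoning
    a : Fin B
    a = fromℕ< x<B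
    toℕ-a : ∀ {v} → v ∈ ⁅ a ⁆ → toℕ v ≡ x
    toℕ-a v∈ = trans (cong toℕ (x∈⁅y⁆⇒x≡y a v∈)) (toℕ-fromℕ< x<B)
    apart : Empty (⁅ a ⁆ ∩ members xs)
    apart (v , v∈) with v∈⁅a⁆ , v∈xs ← x∈p∩q⁻ ⁅ a ⁆ _ v∈ =
      All¬⇒¬Any x∉xs (subst (List._∈ xs) (toℕ-a v∈⁅a⁆) (∈members⁻ v∈xs))
    ⊆members : ⁅ a ⁆ ∪ members xs ⊆ members (x ∷ xs)
    ⊆members v∈ with x∈p∪q⁻ ⁅ a ⁆ _ v∈
    ... | inj₁ v∈⁅a⁆ = ∈members⁺ (here (toℕ-a v∈⁅a⁆))
    ... | inj₂ v∈xs  = ∈members⁺ (there (∈members⁻ v∈xs))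

module PairsOf {s m : ℕ} (es : Fin (s * 2) → Fin m) where

  pairOf : Fin s → Fin m × Fin m
  pairOf i = es (combine i zero) , es (combine i (suc zero))

  pairsOf : List (Fin m × Fin m)
  pairsOf = map pairOf (List.allFin s)

  length-pairsOf : length pairsOf ≡ s
  length-pairsOf = trans (length-map pairOf (List.allFin s)) (length-tabulate (λ i → i))

  ∈cover-map⁻ : ∀ {v} xs → v ∈ cover (map pairOf xs) → ∃[ i ] ∃[ b ] i List.∈ xs × v ≡ es (combine i b)
  ∈cover-map⁻ xs v∈ with e , f , ef∈ , v≡ ← ∈cover⁻ (map pairOf xs) v∈
                    with i , i∈xs , refl ← ∈-map⁻ pairOf ef∈ with v≡
  ... | inj₁ v≡e = i , zero , i∈xs , v≡e
  ... | inj₂ v≡f = i , suc zero , i∈xs , v≡f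

  ∈pairsOf⁻ : ∀ {e f} → (e , f) List.∈ pairsOf → ∃[ i ] (e , f) ≡ pairOf i
  ∈pairsOf⁻ ef∈ with i , _ , eq ← ∈-map⁻ pairOf ef∈ = i , eq

  pairsOf-matching : Injective _≡_ _≡_ es → IsMatching pairsOf
  pairsOf-matching inj = matching (List.allFin s) (allFin⁺ s)
    where
    matching : ∀ xs → Unique xs → IsMatching (map pairOf xs)
    matching []       _               = _
    matching (i ∷ xs) (i∉xs ∷ unique) = zero≢one , notLater zero , notLater (suc zero) , matching xs unique
      where
      zero≢one : es (combine i zero) ≢ es (combine i (suc zero))
      zero≢one eq with () ← proj₂ (combine-injective i zero i (suc zero) (inj eq))
      notLater : ∀ b → es (combine i b) ∉ cover (map pairOf xs)
      notLater b ∈rest with j , b′ , j∈xs , eq ← ∈cover-map⁻ xs ∈rest =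
        All¬⇒¬Any i∉xs (subst (List._∈ xs) (sym (proj₁ (combine-injective i b j b′ (inj eq)))) j∈xs)

T-not-does-∧⁺ : ∀ {P : Set} (P? : Dec P) {b} → ¬ P → T b → T (not (does P?) ∧ b)
T-not-does-∧⁺ (no  _) _  tb = tb
T-not-does-∧⁺ (yes p) ¬p _  = ¬p p

T-not-does-∧⁻ : ∀ {P : Set} (P? : Dec P) {b} → T (not (does P?) ∧ b) → ¬ P × T b
T-not-does-∧⁻ (no ¬p) tb = ¬p , tb

module _ {n : ℕ} (H : Hypergraph n) where
  open Hypergraph H using (V) renaming (m to M)

  lineGraph : Fin M → Subset M
  lineGraph e = tabulate (inN H e)

  meets-sym : ∀ e f → meets H e f ≡ meets H f e
  meets-sym e f = cong or (map-cong (λ v → ∧-comm (V e v) (V f v)) (allFin n))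

  ∈lineGraph⁺ : ∀ {e f} → f ≢ e → T (meets H e f) → f ∈ lineGraph e
  ∈lineGraph⁺ {e} {f} f≢e e∩f = ∈tabulate⁺ {f = inN H e} (T-not-does-∧⁺ (f ≟ e) f≢e e∩f)

  ∈lineGraph⁻ : ∀ {e f} → f ∈ lineGraph e → f ≢ e × T (meets H e f)
  ∈lineGraph⁻ {e} {f} f∈ = T-not-does-∧⁻ (f ≟ e) (∈tabulate⁻ {f = inN H e} f∈)

  lineGraph-sym : SymmetricAdjacency lineGraph
  lineGraph-sym {e} {f} f∈ with f≢e , e∩f ← ∈lineGraph⁻ f∈ =
    ∈lineGraph⁺ (f≢e ∘ sym) (subst T (meets-sym e f) e∩f)

  ∣lineGraph∩lineGraph∣ : ∀ e f → ∣ lineGraph e ∩ lineGraph f ∣ ≡ commonNbrs H e f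
  ∣lineGraph∩lineGraph∣ e f = trans (cong ∣_∣ (tabulate∩tabulate (inN H e) (inN H f)))
                                    (∣tabulate∣≡length-filter (λ g → inN H e g ∧ inN H f g) (λ g → g))

  edgeChoosable : ∀ k (P : List (Fin M × Fin M)) → M ≤ k + length P → length P ≤ k → IsMatching P →
                  (∀ {e f} → e ∈ cover P → f ∈ cover P → T (meets H e f)) →
                  (∀ {e f} → (e , f) List.∈ P → commonNbrs H e f + 2 ≤ k) →
                  EdgeChoosable H k
  edgeChoosable k P M≤k+∣P∣ ∣P∣≤k matching intersecting sparse C unique large = φ , φ-proper , φ∈C
    where
    B : ℕ
    B = suc (max 0 (concat (map C (List.allFin M))))

    C<B : ∀ e → All (_< B) (C e)
    C<B e = All.tabulate λ a∈ →
      s≤s (All.lookup (xs≤max 0 _) (∈-concat⁺′ a∈ (∈-map⁺ C (∈-allFin e))))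

    lists : Fin M → Subset B
    lists e = members B (C e)

    inv : Invariant lineGraph lists ⊤ k P
    inv = record
      { lists-large  = λ {e} _ → ≤-trans (large e) (length≤∣members∣ B (unique e) (C<B e))
      ; S-small      = subst (_≤ k + length P) (sym (∣⊤∣≡n M)) M≤k+∣P∣
      ; P-short      = ∣P∣≤k
      ; matching     = matching
      ; cover⊆S      = ⊆⊤
      ; cover-clique = λ e∈ f∈ e≢f → ∈lineGraph⁺ (e≢f ∘ sym) (intersecting e∈ f∈)
      ; sparse       = λ {e} {f} ef∈P → subst (λ s → s + 2 ≤ k)
          (sym (trans (cong (λ U → ∣ lineGraph e ∩ U ∣) (∩-identityʳ (lineGraph f))) (∣lineGraph∩lineGraph∣ e f)))
          (sparse ef∈P)
      }

    col : Colouring (Adjacent lineGraph) lists ⊤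
    col = colourable lineGraph lineGraph-sym inv

    φ : Fin M → ℕ
    φ e = toℕ (Colouring.colour col (∈⊤ {x = e}))

    φ-proper : Proper H φ
    φ-proper e f e≢f e∩f = Colouring.proper col ∈⊤ ∈⊤ e≢f (∈lineGraph⁺ (e≢f ∘ sym) e∩f) ∘ toℕ-injective

    φ∈C : ∀ e → φ e List.∈ C e
    φ∈C e = ∈members⁻ B (Colouring.colour∈ col ∈⊤)

  pairedEdges⇒edgeChoosable : ∀ {s} k (es : Fin (s * 2) → Fin M) →
                              Injective _≡_ _≡_ es → PairwiseIntersecting H es → M ≤ k + s → s ≤ k →
                              (∀ i → commonNbrs H (es (combine i zero)) (es (combine i (suc zero))) + 2 ≤ k) →
                              EdgeChoosable H k
  pairedEdges⇒edgeChoosable {s} k es inj intersecting M≤k+s s≤k sparse =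
    edgeChoosable k pairsOf (subst (λ l → M ≤ k + l) (sym length-pairsOf) M≤k+s)
      (subst (_≤ k) (sym length-pairsOf) s≤k) (pairsOf-matching inj) pairs-intersect pairs-sparse
    where
    open PairsOf {s = s} es
    pairs-intersect : ∀ {e f} → e ∈ cover pairsOf → f ∈ cover pairsOf → T (meets H e f)
    pairs-intersect e∈ f∈ with _ , _ , _ , refl ← ∈cover-map⁻ (List.allFin s) e∈
                            | _ , _ , _ , refl ← ∈cover-map⁻ (List.allFin s) f∈ = intersecting _ _
    pairs-sparse : ∀ {e f} → (e , f) List.∈ pairsOf → commonNbrs H e f + 2 ≤ k
    pairs-sparse ef∈ with i , refl ← ∈pairsOf⁻ ef∈ = sparse i

m*2≤n+m⇒m≤n : ∀ m n → m * 2 ≤ n + m → m ≤ n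
m*2≤n+m⇒m≤n m n m*2≤n+m = +-cancelʳ-≤ m m n (begin
  m + m      ≡⟨ cong (m +_) (+-identityʳ m) ⟨
  2 * m      ≡⟨ *-comm 2 m ⟩
  m * 2      ≤⟨ m*2≤n+m ⟩
  n + m      ∎)
  where open ≤-Reasoning

proposition4p3 : (n t : ℕ) (H : Hypergraph n) →
    t * n < Hypergraph.m H →
    (es : Fin (suc (Hypergraph.m H ∸ t * n) * 2) → Fin (Hypergraph.m H)) →
    Injective _≡_ _≡_ es →
    PairwiseIntersecting H es →
    (∀ (i : Fin (suc (Hypergraph.m H ∸ t * n))) →
      Useful H t (es (combine i zero)) (es (combine i (suc zero)))) →
    ListChromaticIndexLessThan H (t * n)
proposition4p3 n t H tn<M es inj intersecting useful =
  k , ≤-reflexive (sym tn≡1+k) ,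
  pairedEdges⇒edgeChoosable H k es inj intersecting (≤-reflexive M≡k+1+r) 1+r≤k sparse
  where
  open Hypergraph H using () renaming (m to M)

  r k : ℕ
  r = M ∸ t * n
  k = pred (t * n)

  0<tn : 0 < t * n
  0<tn = ≤-trans (s≤s z≤n) (≤-trans (m≤n+m 3 _) (proj₂ (proj₂ (useful zero))))

  tn≡1+k : t * n ≡ suc k
  tn≡1+k = sym (suc-pred (t * n) {{>-nonZero 0<tn}})

  M≡k+1+r : M ≡ k + suc r
  M≡k+1+r = trans (sym (m+[n∸m]≡n (<⇒≤ tn<M))) (trans (cong (_+ r) tn≡1+k) (sym (+-suc k r)))

  1+r≤k : suc r ≤ k
  1+r≤k = m*2≤n+m⇒m≤n (suc r) k (subst (suc r * 2 ≤_) M≡k+1+r (injective⇒≤ inj))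

  sparse : ∀ i → commonNbrs H (es (combine i zero)) (es (combine i (suc zero))) + 2 ≤ k
  sparse i = ≤-pred (subst₂ _≤_ (+-suc _ 2) tn≡1+k (proj₂ (proj₂ (useful i))))
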